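{- Let $\alpha$ be a restricted growth function of length $n$ with $k=\max\alpha$, and let $\pi=p_1\ldots p_n=\gamma(\alpha)$ be its Burge transpose, so that $\pi$ is the concatenation of blocks $p_{i_{j-1}+1}\ldots p_{i_j}$ ($j=1,\dots,k$, $i_0=0$, $i_k=n$), where the $j$th block lists the positions of the value $j$ in $\alpha$ in decreasing order. For each $i\in[n]$ let $\ell_i$ be the unique $j$ with $i_{j-1}<i\le i_j$ (the $i$th entry of the weakly increasing rearrangement of $\alpha$). Then: (a) $\mathrm{Asc}\,\pi=\{1,i_1+1,i_2+1,\dots,i_{k-1}+1\}$; (b) for all $i<j$, $\mathrm{asc}(p_i\ldots p_j)=\ell_j-\ell_i+1$.
   Context: A restricted growth function is a word $\alpha=a_1\ldots a_n$ of positive integers with $a_1=1$ and $a_{i+1}\le1+\max(a_1\ldots a_i)$ for all $i\in[n-1]$. For a word $w=w_1\ldots w_m$, an index $t$ is an ascent if $t=1$ or $w_t>w_{t-1}$; $\mathrm{Asc}\,w$ is the set of ascents and $\mathrm{asc}\,w$ its cardinality (so the first position of any nonempty word, in particular of the subword $p_i\ldots p_j$, is always counted). The Burge transpose $\gamma(\alpha)$ is equivalently obtained by transposing the biword $\binom{12\ldots n}{\alpha}$: turn each column upside down and sort columns by top entry, with bottom entries weakly decreasing among equal tops; the bottom row is $\gamma(\alpha)$ and the top row is $\ell_1\ldots\ell_n$. -}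

module Defs where

open import Data.Nat using (ℕ; zero; suc; _+_; _∸_; _≤_; _⊔_; _≡ᵇ_; _<ᵇ_; _≤ᵇ_)
open import Data.Bool using (Bool; true; false; _∨_; if_then_else_)
open import Data.List using (List; []; _∷_; length; map; upTo; take; drop; reverse; concatMap; foldr)
open import Data.Product using (_×_)
open import Data.Unit using (⊤)
open import Data.Nat.ListAction using (sum)
open import Relation.Binary.PropositionalEquality using (_≡_)

-- Words are lists of naturals; positions are 1-indexed.

-- 1-indexed lookup  w_t  (default 0 outside 1..length w; only used in range)
at : List ℕ → ℕ → ℕ
at []       _             = 0
at (x ∷ xs) zero          = 0
at (x ∷ xs) (suc zero)    = x
at (x ∷ xs) (suc (suc t)) = at xs (suc t)

range : ℕ → List ℕ
range n = map suc (upTo n)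

-- restricted growth function: a₁ = 1, all aᵢ ≥ 1, a_{i+1} ≤ 1 + max(a₁…aᵢ)
-- (the argument m is the running maximum, initially 0)
RGF-from : ℕ → List ℕ → Set
RGF-from m []       = ⊤
RGF-from m (a ∷ as) = (1 ≤ a) × (a ≤ suc m) × RGF-from (m ⊔ a) as

RGF : List ℕ → Set
RGF α = RGF-from 0 α

maxW : List ℕ → ℕ
maxW = foldr _⊔_ 0

burge : List ℕ → List ℕ
burge α = concatMap (λ j → reverse (filterPos j (range (length α)))) (range (maxW α))
  where
  filterPos : ℕ → List ℕ → List ℕ
  filterPos j []       = []
  filterPos j (i ∷ is) = if at α i ≡ᵇ j then i ∷ filterPos j is else filterPos j is

-- block end i_j = |{ i : αᵢ ≤ j }|  (so i₀ = 0, i_k = n, and block j has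
-- length = number of occurrences of j)
countLe : ℕ → List ℕ → ℕ
countLe j []       = 0
countLe j (a ∷ as) = (if a ≤ᵇ j then 1 else 0) + countLe j as

blockEnd : List ℕ → ℕ → ℕ
blockEnd α j = countLe j α

ascAt : List ℕ → ℕ → Bool
ascAt w t = (t ≡ᵇ 1) ∨ (at w (t ∸ 1) <ᵇ at w t)

Asc : List ℕ → ℕ → Set
Asc w t = (1 ≤ t) × (t ≤ length w) × (ascAt w t ≡ true)

asc : List ℕ → ℕ
asc w = sum (map (λ t → if ascAt w t then 1 else 0) (range (length w)))

-- subword p_i … p_j (1-indexed, inclusive)
subword : List ℕ → ℕ → ℕ → List ℕ
subword p i j = take (suc j ∸ i) (drop (i ∸ 1) p)

{-# OPTIONS --safe #-}

-- Every block is nonempty and strictly decreasing, and since α is a restricted growth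
-- function some occurrence of j precedes some occurrence of j + 1; so the last entry of B_j (the first
-- occurrence of j) is smaller than the first entry of B_{j+1} (the last occurrence of j + 1). Hence the
-- ascents of π are its first position and the first positions i_j + 1 of the later blocks. Extending
-- p_i … p_j by one letter adds an ascent exactly when a block boundary is crossed, i.e. exactly when ℓ
-- grows by one, so asc (p_i … p_j) telescopes to ℓ_j − ℓ_i + 1.

module Submission where

open import Defs
open import Data.Nat using (ℕ; _+_; _∸_; _≤_; _<_)
open import Data.List using (List; length)
open import Data.Product using (_×_; ∃)
open import Data.Sum using (_⊎_)
open import Function.Bundles using (_⇔_)
open import Relation.Binary.PropositionalEquality using (_≡_)

open import Data.Bool using (Bool; true; false; T; if_then_else_; _∨_)
open import Data.Bool.Properties using (T-≡)
open import Data.Empty using (⊥-elim)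
open import Data.List using ([]; _∷_; [_]; _++_; _∷ʳ_; map; take; drop; reverse; upTo; concatMap)
open import Data.List.Properties
  using (length-++; length-map; length-reverse; length-take; map-++; map-upTo; map-cong-local; upTo-∷ʳ;
         concatMap-++; concatMap-cong; ++-identityʳ; unfold-reverse)
open import Data.List.Membership.Propositional using (_∈_)
open import Data.List.Membership.Propositional.Properties using (∈-applyUpTo⁺; ∈-length)
open import Data.List.Relation.Unary.All as All using (All; []; _∷_)
open import Data.List.Relation.Unary.All.Properties as All using ()
open import Data.List.Relation.Unary.Any using (here; there)
open import Data.List.Relation.Unary.Any.Properties as Any using ()
open import Data.List.Relation.Unary.AllPairs using (AllPairs; []; _∷_)
open import Data.List.Relation.Unary.AllPairs.Properties as AllPairs using ()
open import Data.List.Relation.Unary.Linked using (Linked; []; [-]; _∷_)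
open import Data.List.Relation.Unary.Linked.Properties using (AllPairs⇒Linked)
open import Data.Nat using (zero; suc; _>_; _⊔_; _≡ᵇ_; _<ᵇ_; _≤ᵇ_; z≤n; s≤s; _≟_; _≤?_)
open import Data.Nat.ListAction using (sum)
open import Data.Nat.ListAction.Properties using (sum-++)
open import Data.Nat.Properties
open import Algebra.Properties.CommutativeSemigroup +-commutativeSemigroup using (xy∙z≈xz∙y; interchange)
open import Data.Product as Product using (_,_; ∃₂; proj₁; proj₂)
open import Data.Sum using (inj₁; inj₂)
open import Function.Base using (flip; const; _∘′_)
open import Function.Bundles using (mk⇔; module Equivalence)
open import Relation.Binary.Definitions using (tri<; tri≈; tri>)
open import Relation.Binary.PropositionalEquality
  using (_≢_; refl; sym; trans; cong; cong₂; subst; subst₂; module ≡-Reasoning)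
open import Relation.Nullary using (¬_; yes; no)
open import Relation.Nullary.Reflects using (ofʸ; ofⁿ)

indicator : Bool → ℕ
indicator b = if b then 1 else 0

Rise : List ℕ → ℕ → Set
Rise w x = at w x < at w (suc x)

at-++ˡ : ∀ (w v : List ℕ) {i} → i ≤ length w → at (w ++ v) i ≡ at w i
at-++ˡ []      []      z≤n = refl
at-++ˡ []      (_ ∷ _) z≤n = refl
at-++ˡ (x ∷ w) v {zero}        _         = refl
at-++ˡ (x ∷ w) v {suc zero}    _         = refl
at-++ˡ (x ∷ w) v {suc (suc i)} (s≤s i<) = at-++ˡ w v i<

at-++ʳ : ∀ (w v : List ℕ) {n} → length w ≡ n → ∀ i → at (w ++ v) (suc (n + i)) ≡ at v (suc i)
at-++ʳ []          v refl i = refl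
at-++ʳ (x ∷ [])    v refl i = refl
at-++ʳ (x ∷ y ∷ w) v refl i = at-++ʳ (y ∷ w) v refl i

at-++-last : ∀ (w v : List ℕ) → 1 ≤ length v → at (w ++ v) (length (w ++ v)) ≡ at v (length v)
at-++-last w v@(_ ∷ v′) _ =
  trans (cong (at (w ++ v)) (trans (length-++ w) (+-suc (length w) (length v′)))) (at-++ʳ w v refl (length v′))

at-∷ʳ-last : ∀ (w : List ℕ) x → at (w ∷ʳ x) (suc (length w)) ≡ x
at-∷ʳ-last w x = trans (cong (λ i → at (w ∷ʳ x) (suc i)) (sym (+-identityʳ (length w)))) (at-++ʳ w [ x ] refl 0)

at-take : ∀ m (w : List ℕ) {i} → suc i ≤ m → at (take m w) (suc i) ≡ at w (suc i)
at-take (suc m) []      _               = refl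
at-take (suc m) (x ∷ w) {zero}  _       = refl
at-take (suc m) (x ∷ w) {suc i} (s≤s i<m) = at-take m w i<m

at-drop : ∀ m (w : List ℕ) i → at (drop m w) (suc i) ≡ at w (suc (m + i))
at-drop zero    w       i = refl
at-drop (suc m) []      i = refl
at-drop (suc m) (x ∷ w) i = at-drop m w i

≤-length-drop : ∀ m (w : List ℕ) {d} → suc (m + d) ≤ length w → suc d ≤ length (drop m w)
≤-length-drop zero    w       le       = le
≤-length-drop (suc m) (x ∷ w) (s≤s le) = ≤-length-drop m w le

Linked-at : ∀ {R : ℕ → ℕ → Set} {w} → Linked R w → ∀ i → suc i < length w → R (at w (suc i)) (at w (suc (suc i)))
Linked-at (r ∷ _)  zero    _         = r
Linked-at (_ ∷ rs) (suc i) (s≤s i<n) = Linked-at rs i i<n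
Linked-at [-]      _       (s≤s ())

AllPairs-reverse : ∀ {R : ℕ → ℕ → Set} {w} → AllPairs R w → AllPairs (flip R) (reverse w)
AllPairs-reverse {w = []}    []        = []
AllPairs-reverse {w = x ∷ w} (rx ∷ rw) rewrite unfold-reverse x w =
  AllPairs.++⁺ (AllPairs-reverse rw) ([] ∷ []) (All.tabulate (λ y∈ → All.lookup rx (Any.reverse⁻ y∈) ∷ []))

at-head-≥ : ∀ {w y} → AllPairs _>_ w → y ∈ w → y ≤ at w 1
at-head-≥ (_  ∷ _) (here refl) = ≤-refl
at-head-≥ (rx ∷ _) (there y∈)  = <⇒≤ (All.lookup rx y∈)

at-last-≤ : ∀ {w y} → AllPairs _>_ w → y ∈ w → at w (length w) ≤ y
at-last-≤ {_ ∷ []}    _         (here refl) = ≤-refl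
at-last-≤ {_ ∷ _ ∷ _} (rx ∷ rw) (here refl) = ≤-trans (at-last-≤ rw (here refl)) (<⇒≤ (All.lookup rx (here refl)))
at-last-≤ {_ ∷ _ ∷ _} (_ ∷ rw)  (there y∈)  = at-last-≤ rw y∈

-- Counting ascents

range-∷ʳ : ∀ n → range (suc n) ≡ range n ∷ʳ suc n
range-∷ʳ n = trans (cong (map suc) (sym (upTo-∷ʳ n))) (map-++ suc (upTo n) [ n ])

range-∷ : ∀ n → range (suc n) ≡ 1 ∷ map suc (range n)
range-∷ n = cong (λ l → 1 ∷ map suc l) (sym (map-upTo suc n))

sum-range-suc : ∀ (f : ℕ → ℕ) n → sum (map f (range (suc n))) ≡ sum (map f (range n)) + f (suc n)
sum-range-suc f n = begin
  sum (map f (range (suc n)))               ≡⟨ cong (sum ∘′ map f) (range-∷ʳ n) ⟩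
  sum (map f (range n ∷ʳ suc n))            ≡⟨ cong sum (map-++ f (range n) [ suc n ]) ⟩
  sum (map f (range n) ++ [ f (suc n) ])    ≡⟨ sum-++ (map f (range n)) [ f (suc n) ] ⟩
  sum (map f (range n)) + (f (suc n) + 0)   ≡⟨ cong (sum (map f (range n)) +_) (+-identityʳ (f (suc n))) ⟩
  sum (map f (range n)) + f (suc n)         ∎
  where open ≡-Reasoning

sum-range-cong : ∀ {f g : ℕ → ℕ} n → (∀ {t} → t ≤ n → f t ≡ g t) → sum (map f (range n)) ≡ sum (map g (range n))
sum-range-cong n f≗g = cong sum (map-cong-local (All.map f≗g range-≤))
  where
  range-≤ : All (_≤ n) (range n)
  range-≤ = subst (All (_≤ n)) (sym (map-upTo suc n)) (All.applyUpTo⁺₁ suc n (λ i<n → i<n))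

ascAt-∷ʳ : ∀ w x {t} → t ≤ length w → ascAt (w ∷ʳ x) t ≡ ascAt w t
ascAt-∷ʳ w x {t} t≤ =
  cong₂ (λ u v → (t ≡ᵇ 1) ∨ (u <ᵇ v)) (at-++ˡ w [ x ] (≤-trans (m∸n≤m t 1) t≤)) (at-++ˡ w [ x ] t≤)

asc-∷ʳ : ∀ y ys x → asc ((y ∷ ys) ∷ʳ x) ≡ asc (y ∷ ys) + indicator (at (y ∷ ys) (suc (length ys)) <ᵇ x)
asc-∷ʳ y ys x = begin
  asc (w ∷ʳ x)                                          ≡⟨ cong (λ n → sum (map f (range n))) length-w∷ʳx ⟩
  sum (map f (range (suc (length w))))                  ≡⟨ sum-range-suc f (length w) ⟩
  sum (map f (range (length w))) + f (suc (length w))   ≡⟨ cong₂ _+_ (sum-range-cong (length w) (cong indicator ∘′ ascAt-∷ʳ w x))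
                                                                     (cong indicator last-ascent) ⟩
  asc w + indicator (at w (length w) <ᵇ x)              ∎
  where
  open ≡-Reasoning
  w = y ∷ ys
  f = λ t → indicator (ascAt (w ∷ʳ x) t)
  length-w∷ʳx : length (w ∷ʳ x) ≡ suc (length w)
  length-w∷ʳx = trans (length-++ w) (+-comm (length w) 1)
  last-ascent : ascAt (w ∷ʳ x) (suc (length w)) ≡ (at w (length w) <ᵇ x)
  last-ascent = cong₂ _<ᵇ_ (at-++ˡ w [ x ] ≤-refl) (at-∷ʳ-last w x)

take-suc-∷ʳ : ∀ d (w : List ℕ) → suc d < length w → take (suc (suc d)) w ≡ take (suc d) w ∷ʳ at w (suc (suc d))
take-suc-∷ʳ zero    (x ∷ y ∷ w) _        = refl
take-suc-∷ʳ zero    (x ∷ [])    (s≤s ())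
take-suc-∷ʳ (suc d) (x ∷ w)     (s≤s lt) = cong (x ∷_) (take-suc-∷ʳ d w lt)

asc-take-one : ∀ (w : List ℕ) → 1 ≤ length w → asc (take 1 w) ≡ 1
asc-take-one (x ∷ w) _ = refl

asc-take-suc : ∀ d (w : List ℕ) → suc d < length w →
  asc (take (suc (suc d)) w) ≡ asc (take (suc d) w) + indicator (at w (suc d) <ᵇ at w (suc (suc d)))
asc-take-suc d w@(y ∷ w′) (s≤s d<) = begin
  asc (take (suc (suc d)) w)                          ≡⟨ cong asc (take-suc-∷ʳ d w (s≤s d<)) ⟩
  asc ((y ∷ take d w′) ∷ʳ x)                          ≡⟨ asc-∷ʳ y (take d w′) x ⟩
  asc (take (suc d) w) + indicator (at (take (suc d) w) (suc (length (take d w′))) <ᵇ x)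
                                                      ≡⟨ cong (λ u → asc (take (suc d) w) + indicator (u <ᵇ x)) last ⟩
  asc (take (suc d) w) + indicator (at w (suc d) <ᵇ x) ∎
  where
  open ≡-Reasoning
  x = at w (suc (suc d))
  last : at (take (suc d) w) (suc (length (take d w′))) ≡ at w (suc d)
  last = trans (cong (λ i → at (take (suc d) w) (suc i)) (trans (length-take d w′) (m≤n⇒m⊓n≡m (<⇒≤ d<))))
               (at-take (suc d) w ≤-refl)

-- Words made of decreasing blocks

module Concatenation (block : ℕ → List ℕ) (end : ℕ → ℕ)
  (end-zero : end 0 ≡ 0) (end-suc : ∀ m → end (suc m) ≡ end m + length (block (suc m))) where

  prefix : ℕ → List ℕ
  prefix zero    = []
  prefix (suc m) = prefix m ++ block (suc m)

  concatMap-range : ∀ m → concatMap block (range m) ≡ prefix m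
  concatMap-range zero    = refl
  concatMap-range (suc m) = begin
    concatMap block (range (suc m))                      ≡⟨ cong (concatMap block) (range-∷ʳ m) ⟩
    concatMap block (range m ∷ʳ suc m)                   ≡⟨ concatMap-++ block (range m) [ suc m ] ⟩
    concatMap block (range m) ++ (block (suc m) ++ [])   ≡⟨ cong₂ _++_ (concatMap-range m) (++-identityʳ (block (suc m))) ⟩
    prefix (suc m)                                       ∎
    where open ≡-Reasoning

  length-prefix : ∀ m → length (prefix m) ≡ end m
  length-prefix zero    = sym end-zero
  length-prefix (suc m) =
    trans (length-++ (prefix m)) (trans (cong (_+ length (block (suc m))) (length-prefix m)) (sym (end-suc m)))

  end-mono : ∀ {m m′} → m ≤ m′ → end m ≤ end m′
  end-mono {m′ = zero}   z≤n = ≤-refl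
  end-mono {m′ = suc m′} m≤ with m≤n⇒m<n∨m≡n m≤
  ... | inj₁ (s≤s m≤m′) = ≤-trans (end-mono m≤m′) (subst (end m′ ≤_) (sym (end-suc m′)) (m≤m+n (end m′) _))
  ... | inj₂ refl       = ≤-refl

  end-cancel-< : ∀ {m m′} → end m < end m′ → m < m′
  end-cancel-< lt = ≰⇒> (λ m′≤m → ≤⇒≯ (end-mono m′≤m) lt)

  suc≡end⇒1≤ : ∀ {j x} → suc x ≡ end j → 1 ≤ j
  suc≡end⇒1≤ x≡end = end-cancel-< (subst₂ _<_ (sym end-zero) x≡end (s≤s z≤n))

  Boundary : ℕ → ℕ → Set
  Boundary m x = ∃ λ j → j < m × x ≡ end j

  -- InBlock a x means ℓ_x = a.
  InBlock : ℕ → ℕ → Set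
  InBlock a x = end (a ∸ 1) < x × x ≤ end a

  InBlock-mono : ∀ {a b x y} → x ≤ y → InBlock a x → InBlock b y → a ≤ b
  InBlock-mono {a} x≤y (after , _) (_ , before) = pred<⇒≤ a (end-cancel-< (<-≤-trans after (≤-trans x≤y before)))
    where
    pred<⇒≤ : ∀ a {b} → a ∸ 1 < b → a ≤ b
    pred<⇒≤ zero    _   = z≤n
    pred<⇒≤ (suc a) a<b = a<b

  InBlock-unique : ∀ {a b x} → InBlock a x → InBlock b x → a ≡ b
  InBlock-unique inA inB = ≤-antisym (InBlock-mono ≤-refl inA inB) (InBlock-mono ≤-refl inB inA)

  InBlock-exists : ∀ m {x} → 1 ≤ x → x ≤ end m → ∃ λ a → InBlock a x
  InBlock-exists zero    1≤x x≤ = ⊥-elim (<⇒≱ 1≤x (subst (_ ≤_) end-zero x≤))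
  InBlock-exists (suc m) {x} 1≤x x≤ with x ≤? end m
  ... | yes x≤end = InBlock-exists m 1≤x x≤end
  ... | no  x≰end = suc m , ≰⇒> x≰end , x≤

  module Blocks (K : ℕ)
    (nonempty   : ∀ {j} → 1 ≤ j → j ≤ K → 1 ≤ length (block j))
    (decreasing : ∀ j → Linked _>_ (block j))
    (linked     : ∀ {j} → 1 ≤ j → j < K → at (block j) (length (block j)) < at (block (suc j)) 1) where

    end-strict : ∀ {j} → j < K → end j < end (suc j)
    end-strict {j} j<K = subst (end j <_) (sym (end-suc j)) (m<m+n (end j) (nonempty (s≤s z≤n) j<K))

    end-positive : ∀ {j} → 1 ≤ j → j ≤ K → 1 ≤ end j
    end-positive 1≤j j≤K = ≤-trans (subst (_< end 1) end-zero (end-strict (≤-trans 1≤j j≤K))) (end-mono 1≤j)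

    InBlock-end : ∀ {j} → 1 ≤ j → j ≤ K → InBlock j (end j)
    InBlock-end {suc j} _ j<K = end-strict j<K , ≤-refl

    InBlock-after-end : ∀ {j} → j < K → InBlock (suc j) (suc (end j))
    InBlock-after-end j<K = ≤-refl , end-strict j<K

    at-prefix-end : ∀ {m} → 1 ≤ m → m ≤ K → at (prefix m) (end m) ≡ at (block m) (length (block m))
    at-prefix-end {suc m} _ m≤K =
      trans (cong (at (prefix (suc m))) (sym (length-prefix (suc m))))
            (at-++-last (prefix m) (block (suc m)) (nonempty (s≤s z≤n) m≤K))

    rise-before-end : ∀ {m s} → suc s < end m →
      Rise (prefix m) (suc s) ⇔ Boundary m (suc s) → Rise (prefix (suc m)) (suc s) ⇔ Boundary (suc m) (suc s)
    rise-before-end {m} {s} s<end ih =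
      mk⇔ (widen ∘′ Equivalence.to ih ∘′ subst₂ _<_ e₁ e₂) (subst₂ _<_ (sym e₁) (sym e₂) ∘′ Equivalence.from ih ∘′ narrow)
      where
      w = prefix m
      in-w : suc (suc s) ≤ length w
      in-w = subst (suc (suc s) ≤_) (sym (length-prefix m)) s<end
      e₁ : at (w ++ block (suc m)) (suc s) ≡ at w (suc s)
      e₁ = at-++ˡ w (block (suc m)) (<⇒≤ in-w)
      e₂ : at (w ++ block (suc m)) (suc (suc s)) ≡ at w (suc (suc s))
      e₂ = at-++ˡ w (block (suc m)) in-w
      widen : Boundary m (suc s) → Boundary (suc m) (suc s)
      widen (j , j<m , e) = j , m<n⇒m<1+n j<m , e
      narrow : Boundary (suc m) (suc s) → Boundary m (suc s)
      narrow (j , s≤s j≤m , e) with m≤n⇒m<n∨m≡n j≤m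
      ... | inj₁ j<m  = j , j<m , e
      ... | inj₂ refl = ⊥-elim (<-irrefl e s<end)

    rise-at-end : ∀ {m s} → suc m ≤ K → suc s ≡ end m → Rise (prefix (suc m)) (suc s) × Boundary (suc m) (suc s)
    rise-at-end {m} {s} m<K s≡end = subst₂ _<_ (sym e₁) (sym e₂) (linked 1≤m m<K) , (m , ≤-refl , s≡end)
      where
      w = prefix m
      1≤m = suc≡end⇒1≤ s≡end
      e₁ : at (w ++ block (suc m)) (suc s) ≡ at (block m) (length (block m))
      e₁ = trans (at-++ˡ w (block (suc m)) (subst (suc s ≤_) (sym (length-prefix m)) (≤-reflexive s≡end)))
                 (trans (cong (at w) s≡end) (at-prefix-end 1≤m (<⇒≤ m<K)))
      e₂ : at (w ++ block (suc m)) (suc (suc s)) ≡ at (block (suc m)) 1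
      e₂ = trans (cong (λ i → at (w ++ block (suc m)) (suc i)) (trans s≡end (sym (+-identityʳ (end m)))))
                 (at-++ʳ w (block (suc m)) (length-prefix m) 0)

    no-rise-after-end : ∀ {m s} → end m ≤ s → suc s < end (suc m) →
      ¬ Rise (prefix (suc m)) (suc s) × ¬ Boundary (suc m) (suc s)
    no-rise-after-end {m} end≤s s<end with m≤n⇒∃[o]m+o≡n end≤s
    ... | u , refl =
        (λ rise → <-asym descent (subst₂ _<_ e₁ e₂ rise))
      , (λ { (j , s≤s j≤m , e) → <-irrefl (sym e) (s≤s (≤-trans (end-mono j≤m) (m≤m+n (end m) u))) })
      where
      w = prefix m
      v = block (suc m)
      in-v : suc u < length v
      in-v = +-cancelˡ-< (end m) (suc u) (length v) (subst₂ _<_ (sym (+-suc (end m) u)) (end-suc m) s<end)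
      descent : at v (suc (suc u)) < at v (suc u)
      descent = Linked-at (decreasing (suc m)) u in-v
      e₁ : at (w ++ v) (suc (end m + u)) ≡ at v (suc u)
      e₁ = at-++ʳ w v (length-prefix m) u
      e₂ : at (w ++ v) (suc (suc (end m + u))) ≡ at v (suc (suc u))
      e₂ = trans (cong (λ i → at (w ++ v) (suc i)) (sym (+-suc (end m) u))) (at-++ʳ w v (length-prefix m) (suc u))

    rise⇔boundary : ∀ m → m ≤ K → ∀ s → suc s < end m → Rise (prefix m) (suc s) ⇔ Boundary m (suc s)
    rise⇔boundary zero    _   s s<end = ⊥-elim (n≮0 (subst (suc s <_) end-zero s<end))
    rise⇔boundary (suc m) m<K s s<end with <-cmp (suc s) (end m)
    ... | tri< s<endm _ _ = rise-before-end s<endm (rise⇔boundary m (<⇒≤ m<K) s s<endm)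
    ... | tri≈ _ s≡end _  = let rise , boundary = rise-at-end m<K s≡end in mk⇔ (const boundary) (const rise)
    ... | tri> _ _ end<s  = let no-rise , no-boundary = no-rise-after-end (≤-pred end<s) s<end
                            in mk⇔ (⊥-elim ∘′ no-rise) (⊥-elim ∘′ no-boundary)

    Asc-prefix : 1 ≤ end K → ∀ t → Asc (prefix K) t ⇔ (t ≡ 1 ⊎ ∃ λ j → 1 ≤ j × j < K × t ≡ end j + 1)
    Asc-prefix 1≤n t = mk⇔ (to t) from
      where
      w = prefix K
      to : ∀ t → Asc w t → t ≡ 1 ⊎ ∃ λ j → 1 ≤ j × j < K × t ≡ end j + 1
      to (suc zero)    _                 = inj₁ refl
      to (suc (suc s)) (_ , t≤ , ascent)
        with Equivalence.to (rise⇔boundary K ≤-refl s (subst (suc (suc s) ≤_) (length-prefix K) t≤))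
                            (<ᵇ⇒< _ _ (Equivalence.from T-≡ ascent))
      ... | j , j<K , s≡end = inj₂ (j , suc≡end⇒1≤ s≡end , j<K , trans (cong suc s≡end) (+-comm 1 (end j)))
      from : t ≡ 1 ⊎ (∃ λ j → 1 ≤ j × j < K × t ≡ end j + 1) → Asc w t
      from (inj₁ refl) = s≤s z≤n , subst (1 ≤_) (sym (length-prefix K)) 1≤n , refl
      from (inj₂ (j , 1≤j , j<K , refl)) with m≤n⇒∃[o]m+o≡n (end-positive 1≤j (<⇒≤ j<K))
      ... | s , s≡end = subst (Asc w) (trans (cong suc s≡end) (+-comm 1 (end j)))
          ( s≤s z≤n
          , subst (suc (suc s) ≤_) (sym (length-prefix K)) s<K
          , Equivalence.to T-≡ (<⇒<ᵇ (Equivalence.from (rise⇔boundary K ≤-refl s s<K) (j , j<K , s≡end))) )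
        where
        s<K : suc s < end K
        s<K = subst (_< end K) (sym s≡end) (<-≤-trans (end-strict j<K) (end-mono j<K))

    InBlock-suc : ∀ {a b} x → suc x ≤ end K → InBlock a x → InBlock b (suc x) →
      a + indicator (at (prefix K) x <ᵇ at (prefix K) (suc x)) ≡ b
    InBlock-suc zero _ (() , _) _
    InBlock-suc {a} {b} (suc s) s<K inA inB
      with at (prefix K) (suc s) <ᵇ at (prefix K) (suc (suc s))
         | <ᵇ-reflects-< (at (prefix K) (suc s)) (at (prefix K) (suc (suc s)))
    ... | false | ofⁿ no-rise = trans (+-identityʳ a) (InBlock-unique (m<n⇒m<1+n (proj₁ inA) , s<end) inB)
      where
      s<end : suc s < end a
      s<end = ≤∧≢⇒< (proj₂ inA) λ s≡end →
        no-rise (Equivalence.from (rise⇔boundary K ≤-refl s s<K) (a , end-cancel-< (subst (_< end K) s≡end s<K) , s≡end))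
    ... | true | ofʸ rise with Equivalence.to (rise⇔boundary K ≤-refl s s<K) rise
    ...   | j , j<K , s≡end = begin
      a + 1   ≡⟨ +-comm a 1 ⟩
      suc a   ≡⟨ cong suc (InBlock-unique inA (subst (InBlock j) (sym s≡end) (InBlock-end (suc≡end⇒1≤ s≡end) (<⇒≤ j<K)))) ⟩
      suc j   ≡⟨ InBlock-unique (subst (λ x → InBlock (suc j) (suc x)) (sym s≡end) (InBlock-after-end j<K)) inB ⟩
      b       ∎
      where open ≡-Reasoning

    in-window : ∀ i₀ {d} → suc (i₀ + d) ≤ end K → suc d ≤ length (drop i₀ (prefix K))
    in-window i₀ ≤K = ≤-length-drop i₀ (prefix K) (subst (_ ≤_) (sym (length-prefix K)) ≤K)

    asc-window : ∀ {a} i₀ → InBlock a (suc i₀) → ∀ d {b} → suc (i₀ + d) ≤ end K → InBlock b (suc (i₀ + d)) →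
      asc (take (suc d) (drop i₀ (prefix K))) + a ≡ suc b
    asc-window {a} i₀ inA zero {b} i≤K inB =
      cong₂ _+_ (asc-take-one (drop i₀ (prefix K)) (in-window i₀ i≤K))
                (InBlock-unique inA (subst (λ x → InBlock b (suc x)) (+-identityʳ i₀) inB))
    asc-window {a} i₀ inA (suc d) {b} j≤K inB = begin
      asc (take (suc (suc d)) q) + a           ≡⟨ cong (_+ a) (asc-take-suc d q (in-window i₀ j≤K)) ⟩
      asc (take (suc d) q) + rise-in-q + a     ≡⟨ cong (λ i → asc (take (suc d) q) + i + a) rise-shift ⟩
      asc (take (suc d) q) + rise + a          ≡⟨ xy∙z≈xz∙y (asc (take (suc d) q)) rise a ⟩
      asc (take (suc d) q) + a + rise          ≡⟨ cong (_+ rise) (asc-window i₀ inA d (<⇒≤ j≤K′) inA′) ⟩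
      suc a′ + rise                            ≡⟨ cong suc (InBlock-suc (suc (i₀ + d)) j≤K′ inA′ inB′) ⟩
      suc b                                    ∎
      where
      open ≡-Reasoning
      w = prefix K
      q = drop i₀ w
      rise = indicator (at w (suc (i₀ + d)) <ᵇ at w (suc (suc (i₀ + d))))
      rise-in-q = indicator (at q (suc d) <ᵇ at q (suc (suc d)))
      j≤K′ : suc (suc (i₀ + d)) ≤ end K
      j≤K′ = subst (_≤ end K) (cong suc (+-suc i₀ d)) j≤K
      inB′ : InBlock b (suc (suc (i₀ + d)))
      inB′ = subst (λ x → InBlock b (suc x)) (+-suc i₀ d) inB
      previous = InBlock-exists K (s≤s z≤n) (<⇒≤ j≤K′)
      a′ = proj₁ previous
      inA′ = proj₂ previous
      rise-shift : rise-in-q ≡ rise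
      rise-shift = cong indicator (cong₂ _<ᵇ_ (at-drop i₀ w d)
        (trans (at-drop i₀ w (suc d)) (cong (λ i → at w (suc i)) (+-suc i₀ d))))

    asc-subword : ∀ {i j a b} → 1 ≤ i → i < j → j ≤ end K → InBlock a i → InBlock b j →
      asc (subword (prefix K) i j) ≡ b ∸ a + 1
    asc-subword {suc i₀} {j} {a} {b} _ i<j j≤K inA inB with m≤n⇒∃[o]m+o≡n (<⇒≤ i<j)
    ... | d , refl = +≡suc⇒≡∸+1 (InBlock-mono (<⇒≤ i<j) inA inB)
      (trans (cong (λ n → asc (take n (drop i₀ (prefix K))) + a) length≡) (asc-window i₀ inA d j≤K inB))
      where
      length≡ : suc (i₀ + d) ∸ i₀ ≡ suc d
      length≡ = trans (+-∸-assoc 1 (m≤m+n i₀ d)) (cong suc (m+n∸m≡n i₀ d))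
      +≡suc⇒≡∸+1 : ∀ {m n o} → n ≤ o → m + n ≡ suc o → m ≡ o ∸ n + 1
      +≡suc⇒≡∸+1 {m} {n} {o} n≤o eq = begin
        m             ≡⟨ sym (m+n∸n≡m m n) ⟩
        m + n ∸ n     ≡⟨ cong (_∸ n) eq ⟩
        suc o ∸ n     ≡⟨ +-∸-assoc 1 n≤o ⟩
        suc (o ∸ n)   ≡⟨ +-comm 1 (o ∸ n) ⟩
        o ∸ n + 1     ∎
        where open ≡-Reasoning

-- The blocks of the Burge transpose

filterPosition : List ℕ → ℕ → List ℕ → List ℕ
filterPosition α j []       = []
filterPosition α j (i ∷ is) = if at α i ≡ᵇ j then i ∷ filterPosition α j is else filterPosition α j is

filterPosition-unique : ∀ α {F : ℕ → List ℕ → List ℕ} → (∀ j → F j [] ≡ []) →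
  (∀ j i is → F j (i ∷ is) ≡ (if at α i ≡ᵇ j then i ∷ F j is else F j is)) →
  ∀ j L → F j L ≡ filterPosition α j L
filterPosition-unique α F[] F∷ j []       = F[] j
filterPosition-unique α F[] F∷ j (i ∷ is) rewrite F∷ j i is | filterPosition-unique α F[] F∷ j is = refl

positions : List ℕ → ℕ → List ℕ
positions α j = filterPosition α j (range (length α))

blocks : List ℕ → ℕ → List ℕ
blocks α j = reverse (positions α j)

-- `burge` filters with a function local to its definition; abstracting `range (length α)` and `reverse`
-- lets unification identify that function with `filterPosition α`.
burge-blocks : ∀ α → burge α ≡ concatMap (blocks α) (range (maxW α))
burge-blocks α with range (length α) | reverse {A = ℕ} | filterPosition-unique α (λ _ → refl) (λ _ _ _ → refl)
... | L | rev | unique = concatMap-cong (λ j → cong rev (unique j L)) (range (maxW α))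

filterPosition-All : ∀ {P : ℕ → Set} α j {L} → All P L → All P (filterPosition α j L)
filterPosition-All α j []                 = []
filterPosition-All α j {i ∷ _} (pi ∷ pL) with at α i ≡ᵇ j
... | true  = pi ∷ filterPosition-All α j pL
... | false = filterPosition-All α j pL

filterPosition-AllPairs : ∀ {R : ℕ → ℕ → Set} α j {L} → AllPairs R L → AllPairs R (filterPosition α j L)
filterPosition-AllPairs α j []                 = []
filterPosition-AllPairs α j {i ∷ _} (ri ∷ rL) with at α i ≡ᵇ j
... | true  = filterPosition-All α j ri ∷ filterPosition-AllPairs α j rL
... | false = filterPosition-AllPairs α j rL

filterPosition-∈ : ∀ α j {i L} → i ∈ L → at α i ≡ j → i ∈ filterPosition α j L
filterPosition-∈ α j {i} (here refl) eq with at α i ≡ᵇ j in e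
... | true  = here refl
... | false = ⊥-elim (subst T e (≡⇒≡ᵇ _ _ eq))
filterPosition-∈ α j {L = i′ ∷ _} (there i∈) eq with at α i′ ≡ᵇ j
... | true  = there (filterPosition-∈ α j i∈ eq)
... | false = filterPosition-∈ α j i∈ eq

blocks-decreasing : ∀ α j → AllPairs _>_ (blocks α j)
blocks-decreasing α j = AllPairs-reverse (filterPosition-AllPairs α j range-increasing)
  where
  range-increasing : AllPairs _<_ (range (length α))
  range-increasing = subst (AllPairs _<_) (sym (map-upTo suc (length α)))
    (AllPairs.applyUpTo⁺₁ suc (length α) (λ i<j _ → s≤s i<j))

∈-blocks : ∀ α {j x} → x < length α → at α (suc x) ≡ j → suc x ∈ blocks α j
∈-blocks α x<n eq = Any.reverse⁺ (filterPosition-∈ α _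
  (subst (_ ∈_) (sym (map-upTo suc (length α))) (∈-applyUpTo⁺ suc x<n)) eq)

-- Only indices ≥ 2 of `a ∷ α` are shifted indices of `α`, hence `map suc (map suc U)`.
filterPosition-shift : ∀ a α j U →
  filterPosition (a ∷ α) j (map suc (map suc U)) ≡ map suc (filterPosition α j (map suc U))
filterPosition-shift a α j []      = refl
filterPosition-shift a α j (u ∷ U) with at α (suc u) ≡ᵇ j
... | true  = cong (suc (suc u) ∷_) (filterPosition-shift a α j U)
... | false = filterPosition-shift a α j U

positions-∷ : ∀ a α j →
  positions (a ∷ α) j ≡ (if a ≡ᵇ j then 1 ∷ map suc (positions α j) else map suc (positions α j))
positions-∷ a α j = trans (cong (filterPosition (a ∷ α) j) (range-∷ (length α)))
  (cong (λ l → if a ≡ᵇ j then 1 ∷ l else l) (filterPosition-shift a α j (upTo (length α))))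

length-positions-∷ : ∀ a α j → length (positions (a ∷ α) j) ≡ indicator (a ≡ᵇ j) + length (positions α j)
length-positions-∷ a α j rewrite positions-∷ a α j with a ≡ᵇ j
... | true  = cong suc (length-map suc (positions α j))
... | false = length-map suc (positions α j)

indicator-T : ∀ {b} → T b → indicator b ≡ 1
indicator-T {true} _ = refl

indicator-<ᵇ-suc : ∀ a m → indicator (a <ᵇ suc m) ≡ indicator (a <ᵇ m) + indicator (a ≡ᵇ m)
indicator-<ᵇ-suc zero    zero    = refl
indicator-<ᵇ-suc zero    (suc m) = refl
indicator-<ᵇ-suc (suc a) zero    = refl
indicator-<ᵇ-suc (suc a) (suc m) = indicator-<ᵇ-suc a m

indicator-≤ᵇ-suc : ∀ a m → indicator (a ≤ᵇ suc m) ≡ indicator (a ≤ᵇ m) + indicator (a ≡ᵇ suc m)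
indicator-≤ᵇ-suc zero    m = refl
indicator-≤ᵇ-suc (suc a) m = indicator-<ᵇ-suc a m

countLe-suc : ∀ m α → countLe (suc m) α ≡ countLe m α + length (positions α (suc m))
countLe-suc m []      = refl
countLe-suc m (a ∷ α) = begin
  indicator (a ≤ᵇ suc m) + countLe (suc m) α
    ≡⟨ cong₂ _+_ (indicator-≤ᵇ-suc a m) (countLe-suc m α) ⟩
  (indicator (a ≤ᵇ m) + indicator (a ≡ᵇ suc m)) + (countLe m α + length (positions α (suc m)))
    ≡⟨ interchange (indicator (a ≤ᵇ m)) (indicator (a ≡ᵇ suc m)) (countLe m α) (length (positions α (suc m))) ⟩
  countLe m (a ∷ α) + (indicator (a ≡ᵇ suc m) + length (positions α (suc m)))
    ≡⟨ cong (countLe m (a ∷ α) +_) (sym (length-positions-∷ a α (suc m))) ⟩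
  countLe m (a ∷ α) + length (positions (a ∷ α) (suc m))
    ∎
  where open ≡-Reasoning

blockEnd-suc : ∀ α m → blockEnd α (suc m) ≡ blockEnd α m + length (blocks α (suc m))
blockEnd-suc α m = trans (countLe-suc m α) (cong (blockEnd α m +_) (sym (length-reverse (positions α (suc m)))))

blockEnd-zero : ∀ {r} α → RGF-from r α → blockEnd α 0 ≡ 0
blockEnd-zero []          _             = refl
blockEnd-zero (zero ∷ _)  (() , _)
blockEnd-zero (suc _ ∷ α) (_ , _ , rgf) = blockEnd-zero α rgf

blockEnd-max : ∀ α {m} → maxW α ≤ m → blockEnd α m ≡ length α
blockEnd-max []      _     = refl
blockEnd-max (a ∷ α) max≤m =
  cong₂ _+_ (indicator-T (≤⇒≤ᵇ (m⊔n≤o⇒m≤o a _ max≤m))) (blockEnd-max α (m⊔n≤o⇒n≤o a _ max≤m))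

-- Occurrences in a restricted growth function

≤-⊔-right : ∀ {a b v} → v ≤ a ⊔ b → a < v → v ≤ b
≤-⊔-right {b = b} {v} v≤a⊔b a<v with v ≤? b
... | yes v≤b = v≤b
... | no  v≰b = ⊥-elim (<⇒≱ (⊔-lub a<v (≰⇒> v≰b)) v≤a⊔b)

running-max-< : ∀ {r a v} → a ≤ suc r → r < v → a ≢ v → r ⊔ a < v
running-max-< a≤ r<v a≢v = ⊔-lub r<v (≤∧≢⇒< (≤-trans a≤ r<v) a≢v)

rgf-occurs : ∀ {r} α → RGF-from r α → ∀ {v} → r < v → v ≤ maxW α →
  ∃ λ x → x < length α × at α (suc x) ≡ v
rgf-occurs []      _              r<v v≤0 = ⊥-elim (<⇒≱ (≤-<-trans z≤n r<v) v≤0)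
rgf-occurs (a ∷ α) (_ , a≤ , rgf) {v} r<v v≤max with a ≟ v
... | yes refl = 0 , s≤s z≤n , refl
... | no  a≢v  = Product.map suc (Product.map₁ s≤s)
  (rgf-occurs α rgf r⊔a<v (≤-⊔-right v≤max (m⊔n<o⇒n<o _ a r⊔a<v)))
  where r⊔a<v = running-max-< a≤ r<v a≢v

rgf-ordered : ∀ {r} α → RGF-from r α → ∀ {v} → r < v → suc v ≤ maxW α →
  ∃₂ λ x y → x < y × y < length α × at α (suc x) ≡ v × at α (suc y) ≡ suc v
rgf-ordered []      _              _   ()
rgf-ordered (a ∷ α) (_ , a≤ , rgf) {v} r<v v<max with a ≟ v
... | yes refl =
  let y , y<n , e = rgf-occurs α rgf (s≤s (⊔-lub (<⇒≤ r<v) ≤-refl)) (≤-⊔-right v<max ≤-refl)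
  in 0 , suc y , s≤s z≤n , s≤s y<n , refl , e
... | no  a≢v  =
  let x , y , x<y , y<n , ex , ey = rgf-ordered α rgf r⊔a<v (≤-⊔-right v<max (m<n⇒m<1+n (m⊔n<o⇒n<o _ a r⊔a<v)))
  in suc x , suc y , s≤s x<y , s≤s y<n , ex , ey
  where r⊔a<v = running-max-< a≤ r<v a≢v

blocks-nonempty : ∀ α → RGF α → ∀ {j} → 1 ≤ j → j ≤ maxW α → 1 ≤ length (blocks α j)
blocks-nonempty α rgf 1≤j j≤k =
  let x , x<n , e = rgf-occurs α rgf 1≤j j≤k in ∈-length (∈-blocks α x<n e)

blocks-linked : ∀ α → RGF α → ∀ {j} → 1 ≤ j → j < maxW α →
  at (blocks α j) (length (blocks α j)) < at (blocks α (suc j)) 1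
blocks-linked α rgf {j} 1≤j j<k =
  let x , y , x<y , y<n , ex , ey = rgf-ordered α rgf 1≤j j<k
  in ≤-<-trans (at-last-≤ (blocks-decreasing α j) (∈-blocks α (<-trans x<y y<n) ex))
               (<-≤-trans (s≤s x<y) (at-head-≥ (blocks-decreasing α (suc j)) (∈-blocks α y<n ey)))

lemma5p1 : (α : List ℕ) → RGF α → 1 ≤ length α →
    ((t : ℕ) → Asc (burge α) t ⇔ (t ≡ 1 ⊎ ∃ λ j → 1 ≤ j × j < maxW α × t ≡ blockEnd α j + 1))
    × ((i j a b : ℕ) → 1 ≤ i → i < j → j ≤ length α →
       blockEnd α (a ∸ 1) < i → i ≤ blockEnd α a →
       blockEnd α (b ∸ 1) < j → j ≤ blockEnd α b →
       asc (subword (burge α) i j) ≡ b ∸ a + 1)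
lemma5p1 α rgf 1≤n =
    (λ t → subst (λ w → Asc w t ⇔ _) (sym burge≡prefix) (Asc-prefix (≤-trans 1≤n n≤end) t))
  , λ i j a b 1≤i i<j j≤n a₁ a₂ b₁ b₂ → subst (λ w → asc (subword w i j) ≡ b ∸ a + 1) (sym burge≡prefix)
      (asc-subword 1≤i i<j (≤-trans j≤n n≤end) (a₁ , a₂) (b₁ , b₂))
  where
  open Concatenation (blocks α) (blockEnd α) (blockEnd-zero α rgf) (blockEnd-suc α)
  open Blocks (maxW α) (blocks-nonempty α rgf) (λ j → AllPairs⇒Linked (blocks-decreasing α j)) (blocks-linked α rgf)
  burge≡prefix : burge α ≡ prefix (maxW α)
  burge≡prefix = trans (burge-blocks α) (concatMap-range (maxW α))
  n≤end : length α ≤ blockEnd α (maxW α)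
  n≤end = ≤-reflexive (sym (blockEnd-max α ≤-refl))
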